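{- Let $x,z$ be formal variables and define rational functions $G_n(w)$ for $n\ge1$ by $G_1(w)=\frac1w$ and, for $n\ge2$, $$G_n(w)=\sum_{k=1}^{n-1}\frac{G_k(w)\,G_{n-k}(w+kz)}{w+(n-1)x}.$$ For integers $1\le k<n$ define $F_{k,n}(w)$ by $F_{1,n}(w)=G_n(w)$ and, for $k\ge2$, $$F_{k,n}(w)=\sum_{i=1}^{n-k-1}\frac{G_{n-k-i}(w+(k+i)z)\,F_{k,k+i}(w)}{w+(n-1)x}+\sum_{i=1}^{k-1}\frac{(w+iz)\,G_i(w+x)\,F_{k-i,n-i}(w+iz)}{w\,(w+(n-1)x)}.$$ Then for each $n\ge3$, $$F_{2,n}(w)=G_n(w)-\frac{G_{n-1}(w+z)}{w(w+x)}.$$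
   Context: All functions are rational functions in $w,x,z$, with $x$ and $z$ treated as constant formal variables and $w$ as the argument. -}

module Defs where

open import Data.Nat as ℕ using (ℕ; zero; suc; _∸_)
open import Data.Integer using (+_)
open import Data.Rational using (ℚ; 0ℚ; 1ℚ; _+_; _*_; _÷_; ≢-nonZero)
import Data.Rational as Q
open import Data.Rational.Properties using (_≟_)
open import Relation.Nullary using (yes; no)

⟦_⟧ : ℕ → ℚ
⟦ n ⟧ = + n Q./ 1

-- total division on ℚ (junk value 0 when the denominator is 0; in the
-- theorem all denominators are assumed nonzero, so the junk is never used)
_//_ : ℚ → ℚ → ℚ
a // b with b ≟ 0ℚ
... | yes _  = 0ℚ
... | no b≢0 = _÷_ a b {{≢-nonZero b≢0}}

infixl 7 _//_

sumTo : ℕ → (ℕ → ℚ) → ℚ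
sumTo zero    f = 0ℚ
sumTo (suc m) f = sumTo m f + f (suc m)

-- G with a fuel argument (fuel n suffices to compute G_n)
Gf : ℕ → ℕ → ℚ → ℚ → ℚ → ℚ
Gf zero    _             _ _ _ = 0ℚ
Gf (suc f) zero          _ _ _ = 0ℚ
Gf (suc f) (suc zero)    w x z = 1ℚ // w
Gf (suc f) (suc (suc m)) w x z =
  sumTo (suc m) (λ k → (Gf f k w x z * Gf f (suc (suc m) ∸ k) (w + ⟦ k ⟧ * z) x z)
                         // (w + ⟦ suc m ⟧ * x))

-- G n w x z = G_n(w), for n ≥ 1 (G 0 is a junk value 0)
G : ℕ → ℚ → ℚ → ℚ → ℚ
G n = Gf n n

-- F with a fuel argument; Ff f k n computes F_{k,n} once f ≥ n
Ff : ℕ → ℕ → ℕ → ℚ → ℚ → ℚ → ℚ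
Ff zero    _             _ _ _ _ = 0ℚ
Ff (suc f) zero          _ _ _ _ = 0ℚ
Ff (suc f) (suc zero)    n w x z = G n w x z
Ff (suc f) (suc (suc j)) n w x z =
  sumTo (n ∸ k ∸ 1)
    (λ i → (G (n ∸ k ∸ i) (w + ⟦ k ℕ.+ i ⟧ * z) x z * Ff f k (k ℕ.+ i) w x z)
             // (w + ⟦ n ∸ 1 ⟧ * x))
  + sumTo (k ∸ 1)
    (λ i → ((w + ⟦ i ⟧ * z) * G i (w + x) x z * Ff f (k ∸ i) (n ∸ i) (w + ⟦ i ⟧ * z) x z)
             // (w * (w + ⟦ n ∸ 1 ⟧ * x)))
  where k = suc (suc j)

F : ℕ → ℕ → ℚ → ℚ → ℚ → ℚ
F k n = Ff n k n

{-# OPTIONS --safe #-}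
module Submission where

-- Multiplying F_{2,n}(w) by w(w+x)(w+(n-1)x) and inserting the claim for
-- the F_{2,k}(w), k < n, turns the first sum into A w(w+x) - S, where A and S are what remains
-- of the recurrences for G_n(w) and G_{n-1}(w+z) after their leading terms, and the second sum
-- into (w+z) G_{n-1}(w+z). Substituting the two recurrences, everything cancels
-- because G_2(w) w(w+x) = G_1(w+z) and (w+x) + (w+z+(n-2)x) - (w+z) = w+(n-1)x.

open import Defs
open import Data.Nat as ℕ using (ℕ; _≤_; _∸_; suc; zero; z≤n; s≤s)
import Data.Nat.Properties as ℕ
import Data.Integer as ℤ
import Data.Integer.Properties as ℤ
open import Data.Rational using (ℚ; 0ℚ; 1ℚ; _+_; _*_; _-_; 1/_; toℚᵘ; ≢-nonZero)
open import Data.Rational.Properties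
import Data.Rational.Unnormalised as ℚᵘ
import Data.Rational.Unnormalised.Properties as ℚᵘ
open import Data.List using (List; _∷_; [])
open import Level using (0ℓ)
open import Algebra.Bundles using (CommutativeMonoid)
open import Algebra.Properties.CommutativeSemigroup
  (CommutativeMonoid.commutativeSemigroup *-1-commutativeMonoid) using (x∙yz≈xz∙y; x∙yz≈yx∙z)
open import Relation.Binary.PropositionalEquality
  using (_≡_; _≢_; refl; sym; trans; cong; cong₂; subst; module ≡-Reasoning)
open import Relation.Nullary using (yes; no; contradiction)
open import Relation.Nullary.Decidable using (dec⇒maybe)
import Tactic.RingSolver.Core.AlmostCommutativeRing as ACR
open import Tactic.RingSolver using (solve-∀; solve)

ℚ-ring : ACR.AlmostCommutativeRing 0ℓ 0ℓ
ℚ-ring = ACR.fromCommutativeRing +-*-commutativeRing (λ q → dec⇒maybe (0ℚ ≟ q))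

⟦⟧-suc : ∀ n → ⟦ suc n ⟧ ≡ 1ℚ + ⟦ n ⟧
⟦⟧-suc n = toℚᵘ-injective (begin
  toℚᵘ ⟦ suc n ⟧                   ≈⟨ toℚᵘ-fromℚᵘ (ℚᵘ.mkℚᵘ (ℤ.+ suc n) 0) ⟩
  ℚᵘ.mkℚᵘ (ℤ.+ suc n) 0            ≈⟨ ℚᵘ.*≡* cross-multiplied ⟩
  ℚᵘ.1ℚᵘ ℚᵘ.+ ℚᵘ.mkℚᵘ (ℤ.+ n) 0    ≈⟨ ℚᵘ.+-congʳ ℚᵘ.1ℚᵘ (ℚᵘ.≃-sym (toℚᵘ-fromℚᵘ (ℚᵘ.mkℚᵘ (ℤ.+ n) 0))) ⟩
  toℚᵘ 1ℚ ℚᵘ.+ toℚᵘ ⟦ n ⟧          ≈⟨ ℚᵘ.≃-sym (toℚᵘ-homo-+ 1ℚ ⟦ n ⟧) ⟩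
  toℚᵘ (1ℚ + ⟦ n ⟧)                ∎)
  where
  open ℚᵘ.≃-Reasoning
  cross-multiplied : ℤ.+ suc n ℤ.* ℤ.+ 1 ≡ (ℤ.+ 1 ℤ.* ℤ.+ 1 ℤ.+ ℤ.+ n ℤ.* ℤ.+ 1) ℤ.* ℤ.+ 1
  cross-multiplied rewrite ℤ.*-identityʳ (ℤ.+ suc n) | ℤ.*-identityʳ (ℤ.+ n)
                         | ℤ.*-identityʳ (ℤ.+ 1 ℤ.+ ℤ.+ n) = refl

//-*-cancel : ∀ a {b} → b ≢ 0ℚ → a // b * b ≡ a
//-*-cancel a {b} b≢0 with b ≟ 0ℚ
... | yes b≡0 = contradiction b≡0 b≢0
... | no  b≢0′ = begin
  a * 1/ b * b    ≡⟨ *-assoc a (1/ b) b ⟩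
  a * (1/ b * b)  ≡⟨ cong (a *_) (*-inverseˡ b) ⟩
  a * 1ℚ          ≡⟨ *-identityʳ a ⟩
  a               ∎
  where open ≡-Reasoning; instance _ = ≢-nonZero b≢0′

*-//-cancel : ∀ a {b} → b ≢ 0ℚ → a * b // b ≡ a
*-//-cancel a {b} b≢0 with b ≟ 0ℚ
... | yes b≡0 = contradiction b≡0 b≢0
... | no  b≢0′ = begin
  a * b * 1/ b    ≡⟨ *-assoc a b (1/ b) ⟩
  a * (b * 1/ b)  ≡⟨ cong (a *_) (*-inverseʳ b) ⟩
  a * 1ℚ          ≡⟨ *-identityʳ a ⟩
  a               ∎
  where open ≡-Reasoning; instance _ = ≢-nonZero b≢0′

//-*-cancelˡ : ∀ a {b} c → b ≢ 0ℚ → a // b * (b * c) ≡ a * c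
//-*-cancelˡ a {b} c b≢0 = trans (sym (*-assoc (a // b) b c)) (cong (_* c) (//-*-cancel a b≢0))

*-cancelʳ-≢0 : ∀ {a b} c → c ≢ 0ℚ → a * c ≡ b * c → a ≡ b
*-cancelʳ-≢0 {a} {b} c c≢0 ac≡bc = begin
  a           ≡⟨ sym (*-//-cancel a c≢0) ⟩
  a * c // c  ≡⟨ cong (_// c) ac≡bc ⟩
  b * c // c  ≡⟨ *-//-cancel b c≢0 ⟩
  b           ∎
  where open ≡-Reasoning

*-≢0 : ∀ {a b} → a ≢ 0ℚ → b ≢ 0ℚ → a * b ≢ 0ℚ
*-≢0 {a} {b} a≢0 b≢0 ab≡0 = a≢0 (*-cancelʳ-≢0 b b≢0 (trans ab≡0 (sym (*-zeroˡ b))))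

sumTo-cong : ∀ m {f g : ℕ → ℚ} → (∀ {i} → 1 ≤ i → i ≤ m → f i ≡ g i) → sumTo m f ≡ sumTo m g
sumTo-cong zero    f≗g = refl
sumTo-cong (suc m) f≗g =
  cong₂ _+_ (sumTo-cong m (λ 1≤i i≤m → f≗g 1≤i (ℕ.m≤n⇒m≤1+n i≤m))) (f≗g (s≤s z≤n) ℕ.≤-refl)

sumTo-sucˡ : ∀ m f → sumTo (suc m) f ≡ f 1 + sumTo m (λ i → f (suc i))
sumTo-sucˡ zero    f = +-comm 0ℚ (f 1)
sumTo-sucˡ (suc m) f =
  trans (cong (_+ f (suc (suc m))) (sumTo-sucˡ m f)) (+-assoc (f 1) _ (f (suc (suc m))))

sumTo-*-distribʳ : ∀ m f c → sumTo m f * c ≡ sumTo m (λ i → f i * c)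
sumTo-*-distribʳ zero    f c = *-zeroˡ c
sumTo-*-distribʳ (suc m) f c =
  trans (*-distribʳ-+ c (sumTo m f) (f (suc m))) (cong (_+ f (suc m) * c) (sumTo-*-distribʳ m f c))

sumTo-*-minus : ∀ m f c g → sumTo m (λ i → f i * c - g i) ≡ sumTo m f * c - sumTo m g
sumTo-*-minus zero    f c g = sym (trans (+-identityʳ (0ℚ * c)) (*-zeroˡ c))
sumTo-*-minus (suc m) f c g =
  trans (cong (_+ (f (suc m) * c - g (suc m))) (sumTo-*-minus m f c g))
        (regroup (sumTo m f) (f (suc m)) c (sumTo m g) (g (suc m)))
  where regroup : ∀ F f c G g → (F * c - G) + (f * c - g) ≡ (F + f) * c - (G + g)
        regroup = solve-∀ ℚ-ring

module GProperties (x z : ℚ) where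

  Gf-zero : ∀ f v → Gf f 0 v x z ≡ 0ℚ
  Gf-zero zero    v = refl
  Gf-zero (suc f) v = refl

  Gf-fuel : ∀ {f g} k v → k ≤ f → k ≤ g → Gf f k v x z ≡ Gf g k v x z
  Gf-fuel {f} {g} zero v _ _ = trans (Gf-zero f v) (sym (Gf-zero g v))
  Gf-fuel {suc f} {suc g} (suc zero) v _ _ = refl
  Gf-fuel {suc f} {suc g} (suc (suc m)) v (s≤s m<f) (s≤s m<g) = sumTo-cong (suc m) term
    where
    term : ∀ {k} → 1 ≤ k → k ≤ suc m →
           (Gf f k v x z * Gf f (suc (suc m) ∸ k) (v + ⟦ k ⟧ * z) x z) // (v + ⟦ suc m ⟧ * x)
           ≡ (Gf g k v x z * Gf g (suc (suc m) ∸ k) (v + ⟦ k ⟧ * z) x z) // (v + ⟦ suc m ⟧ * x)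
    term {suc k} _ k<1+m = cong (_// (v + ⟦ suc m ⟧ * x)) (cong₂ _*_
      (Gf-fuel (suc k) v (ℕ.≤-trans k<1+m m<f) (ℕ.≤-trans k<1+m m<g))
      (Gf-fuel (suc m ∸ k) (v + ⟦ suc k ⟧ * z)
        (ℕ.≤-trans (ℕ.m∸n≤m (suc m) k) m<f) (ℕ.≤-trans (ℕ.m∸n≤m (suc m) k) m<g)))

  Gf≡G : ∀ {f} k v → k ≤ f → Gf f k v x z ≡ G k v x z
  Gf≡G k v k≤f = Gf-fuel k v k≤f ℕ.≤-refl

  G-recurrence : ∀ m v → v + ⟦ suc m ⟧ * x ≢ 0ℚ →
    G (suc (suc m)) v x z * (v + ⟦ suc m ⟧ * x)
    ≡ sumTo (suc m) (λ k → G k v x z * G (suc (suc m) ∸ k) (v + ⟦ k ⟧ * z) x z)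
  G-recurrence m v d≢0 =
    trans (sumTo-*-distribʳ (suc m) _ (v + ⟦ suc m ⟧ * x)) (sumTo-cong (suc m) term)
    where
    term : ∀ {k} → 1 ≤ k → k ≤ suc m →
           (Gf (suc m) k v x z * Gf (suc m) (suc (suc m) ∸ k) (v + ⟦ k ⟧ * z) x z)
             // (v + ⟦ suc m ⟧ * x) * (v + ⟦ suc m ⟧ * x)
           ≡ G k v x z * G (suc (suc m) ∸ k) (v + ⟦ k ⟧ * z) x z
    term {suc k} _ k<1+m = trans (//-*-cancel _ d≢0) (cong₂ _*_
      (Gf≡G (suc k) v k<1+m)
      (Gf≡G (suc m ∸ k) (v + ⟦ suc k ⟧ * z) (ℕ.m∸n≤m (suc m) k)))

  G₁-inverse : ∀ {v} → v ≢ 0ℚ → G 1 v x z * v ≡ 1ℚ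
  G₁-inverse v≢0 = //-*-cancel 1ℚ v≢0

-- The ring identity closing the induction step. Read a, b as w+x, w+z; D, D′ as the
-- denominators w+(n-1)x, (w+z)+(n-2)x; G₁w, G₁a, G₁b, G₂ as G_1(w), G_1(w+x), G_1(w+z), G_2(w).
F₂-key-identity : ∀ w a b D D′ Gn g h A S G₁w G₁a G₁b G₂ →
  D ≡ a + D′ - b →
  G₁w * w ≡ 1ℚ → G₁a * a ≡ 1ℚ → G₂ * a ≡ G₁w * G₁b →
  Gn * D ≡ G₁w * g + G₂ * h + A →
  g * D′ ≡ G₁b * h + S →
  A * (w * a) - S + b * G₁a * g * a ≡ (Gn * (w * a) - g) * D
F₂-key-identity w a b D D′ Gn g h A S G₁w G₁a G₁b G₂ D-split w⁻¹ a⁻¹ G₂-rec Gn-rec g-rec = begin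
  A * (w * a) - S + b * G₁a * g * a
    ≡⟨ solve vars ℚ-ring ⟩
  (G₁w * g + G₂ * h + A) * (w * a) - (G₁b * h + S)
    - G₁w * w * (g * a) - G₂ * a * (w * h) + G₁b * h + G₁a * a * (b * g)
    ≡⟨ cong₂ (λ r s → r * (w * a) - s - G₁w * w * (g * a) - G₂ * a * (w * h) + G₁b * h + G₁a * a * (b * g))
             (sym Gn-rec) (sym g-rec) ⟩
  Gn * D * (w * a) - g * D′ - G₁w * w * (g * a) - G₂ * a * (w * h) + G₁b * h + G₁a * a * (b * g)
    ≡⟨ cong (λ t → Gn * D * (w * a) - g * D′ - G₁w * w * (g * a) - t * (w * h) + G₁b * h + G₁a * a * (b * g))
            G₂-rec ⟩
  Gn * D * (w * a) - g * D′ - G₁w * w * (g * a) - G₁w * G₁b * (w * h) + G₁b * h + G₁a * a * (b * g)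
    ≡⟨ solve vars ℚ-ring ⟩
  Gn * D * (w * a) - g * D′ - G₁w * w * (g * a + G₁b * h) + G₁b * h + G₁a * a * (b * g)
    ≡⟨ cong₂ (λ s t → Gn * D * (w * a) - g * D′ - s * (g * a + G₁b * h) + G₁b * h + t * (b * g)) w⁻¹ a⁻¹ ⟩
  Gn * D * (w * a) - g * D′ - 1ℚ * (g * a + G₁b * h) + G₁b * h + 1ℚ * (b * g)
    ≡⟨ solve vars ℚ-ring ⟩
  Gn * D * (w * a) - g * (a + D′ - b)
    ≡⟨ cong (λ d → Gn * D * (w * a) - g * d) (sym D-split) ⟩
  Gn * D * (w * a) - g * D
    ≡⟨ solve vars ℚ-ring ⟩
  (Gn * (w * a) - g) * D ∎
  where
  open ≡-Reasoning
  vars : List ℚ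
  vars = w ∷ a ∷ b ∷ D ∷ D′ ∷ Gn ∷ g ∷ h ∷ A ∷ S ∷ G₁w ∷ G₁a ∷ G₁b ∷ G₂ ∷ []

F₂-formula : ℕ → ℚ → ℚ → ℚ → ℚ
F₂-formula n w x z = G n w x z - G (n ∸ 1) (w + z) x z // (w * (w + x))

module _ (w x z : ℚ) (w+ax+bz≢0 : ∀ a b → w + ⟦ a ⟧ * x + ⟦ b ⟧ * z ≢ 0ℚ) where
  open GProperties x z

  w+ax≢0 : ∀ a → w + ⟦ a ⟧ * x ≢ 0ℚ
  w+ax≢0 a = subst (_≢ 0ℚ) (drop-z ⟦ a ⟧) (w+ax+bz≢0 a 0)
    where drop-z : ∀ c → w + c * x + 0ℚ * z ≡ w + c * x
          drop-z c = solve (w ∷ x ∷ z ∷ c ∷ []) ℚ-ring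

  w+z+ax≢0 : ∀ a → (w + z) + ⟦ a ⟧ * x ≢ 0ℚ
  w+z+ax≢0 a = subst (_≢ 0ℚ) (one-z ⟦ a ⟧) (w+ax+bz≢0 a 1)
    where one-z : ∀ c → w + c * x + 1ℚ * z ≡ (w + z) + c * x
          one-z c = solve (w ∷ x ∷ z ∷ c ∷ []) ℚ-ring

  w≢0 : w ≢ 0ℚ
  w≢0 = subst (_≢ 0ℚ) (trans (cong (w +_) (*-zeroˡ x)) (+-identityʳ w)) (w+ax≢0 0)

  w+x≢0 : w + x ≢ 0ℚ
  w+x≢0 = subst (_≢ 0ℚ) (cong (w +_) (*-identityˡ x)) (w+ax≢0 1)

  w+1z≡w+z : w + ⟦ 1 ⟧ * z ≡ w + z
  w+1z≡w+z = cong (w +_) (*-identityˡ z)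

  w+z+kz≡w+[1+k]z : ∀ k → (w + z) + ⟦ k ⟧ * z ≡ w + ⟦ suc k ⟧ * z
  w+z+kz≡w+[1+k]z k = trans (regroup ⟦ k ⟧) (cong (λ c → w + c * z) (sym (⟦⟧-suc k)))
    where regroup : ∀ c → (w + z) + c * z ≡ w + (1ℚ + c) * z
          regroup c = solve (w ∷ z ∷ c ∷ []) ℚ-ring

  -- For n = 3 + m: D m is the denominator w + (n-1)x of G_n(w) and F_{2,n}(w), and
  -- A m, S m are the recurrences for G_n(w), G_{n-1}(w+z) stripped of their leading terms,
  -- sharing the factors T m i = G_{n-2-i}(w + (2+i)z).
  D : ℕ → ℚ
  D m = w + ⟦ 2 ℕ.+ m ⟧ * x

  T : ℕ → ℕ → ℚ
  T m i = G (suc m ∸ i) (w + ⟦ 2 ℕ.+ i ⟧ * z) x z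

  A S : ℕ → ℚ
  A m = sumTo m (λ i → G (2 ℕ.+ i) w x z * T m i)
  S m = sumTo m (λ i → G (suc i) (w + z) x z * T m i)

  P : ℚ
  P = w * (w + x)

  D≢0 : ∀ m → D m ≢ 0ℚ
  D≢0 m = w+ax≢0 (2 ℕ.+ m)

  P≢0 : P ≢ 0ℚ
  P≢0 = *-≢0 w≢0 w+x≢0

  D-split : ∀ m → D m ≡ (w + x) + ((w + z) + ⟦ suc m ⟧ * x) - (w + z)
  D-split m = trans (cong (λ c → w + c * x) (⟦⟧-suc (suc m))) (regroup ⟦ suc m ⟧)
    where regroup : ∀ c → w + (1ℚ + c) * x ≡ (w + x) + ((w + z) + c * x) - (w + z)
          regroup c = solve (w ∷ x ∷ z ∷ c ∷ []) ℚ-ring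

  G₂-recurrence : G 2 w x z * (w + x) ≡ G 1 w x z * G 1 (w + z) x z
  G₂-recurrence = begin
    G 2 w x z * (w + x)                       ≡⟨ cong (G 2 w x z *_) (sym (cong (w +_) (*-identityˡ x))) ⟩
    G 2 w x z * (w + ⟦ 1 ⟧ * x)               ≡⟨ G-recurrence 0 w (w+ax≢0 1) ⟩
    0ℚ + G 1 w x z * G 1 (w + ⟦ 1 ⟧ * z) x z  ≡⟨ +-identityˡ _ ⟩
    G 1 w x z * G 1 (w + ⟦ 1 ⟧ * z) x z       ≡⟨ cong (λ v → G 1 w x z * G 1 v x z) w+1z≡w+z ⟩
    G 1 w x z * G 1 (w + z) x z               ∎
    where open ≡-Reasoning

  Gₙ-recurrence : ∀ m →
    G (3 ℕ.+ m) w x z * D m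
    ≡ G 1 w x z * G (2 ℕ.+ m) (w + z) x z + G 2 w x z * G (suc m) (w + ⟦ 2 ⟧ * z) x z + A m
  Gₙ-recurrence m = begin
    G (3 ℕ.+ m) w x z * D m                ≡⟨ G-recurrence (suc m) w (D≢0 m) ⟩
    sumTo (2 ℕ.+ m) h                      ≡⟨ sumTo-sucˡ (suc m) h ⟩
    h 1 + sumTo (suc m) (λ i → h (suc i))  ≡⟨ cong (h 1 +_) (sumTo-sucˡ m (λ i → h (suc i))) ⟩
    h 1 + (h 2 + A m)                      ≡⟨ sym (+-assoc (h 1) (h 2) (A m)) ⟩
    h 1 + h 2 + A m                        ≡⟨ cong (λ v → G 1 w x z * G (2 ℕ.+ m) v x z + h 2 + A m) w+1z≡w+z ⟩
    G 1 w x z * G (2 ℕ.+ m) (w + z) x z + h 2 + A m ∎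
    where
    open ≡-Reasoning
    h : ℕ → ℚ
    h k = G k w x z * G (3 ℕ.+ m ∸ k) (w + ⟦ k ⟧ * z) x z

  Gₙ₋₁-recurrence : ∀ m →
    G (2 ℕ.+ m) (w + z) x z * ((w + z) + ⟦ suc m ⟧ * x)
    ≡ G 1 (w + z) x z * G (suc m) (w + ⟦ 2 ⟧ * z) x z + S m
  Gₙ₋₁-recurrence m = begin
    G (2 ℕ.+ m) (w + z) x z * ((w + z) + ⟦ suc m ⟧ * x)  ≡⟨ G-recurrence m (w + z) (w+z+ax≢0 (suc m)) ⟩
    sumTo (suc m) h                                       ≡⟨ sumTo-sucˡ m h ⟩
    h 1 + sumTo m (λ i → h (suc i))
      ≡⟨ cong₂ _+_ (cong (λ v → G 1 (w + z) x z * G (suc m) v x z) (w+z+kz≡w+[1+k]z 1))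
                   (sumTo-cong m (λ {i} _ _ → cong (λ v → G (suc i) (w + z) x z * G (suc m ∸ i) v x z)
                                                   (w+z+kz≡w+[1+k]z (suc i)))) ⟩
    G 1 (w + z) x z * G (suc m) (w + ⟦ 2 ⟧ * z) x z + S m ∎
    where
    open ≡-Reasoning
    h : ℕ → ℚ
    h k = G k (w + z) x z * G (2 ℕ.+ m ∸ k) ((w + z) + ⟦ k ⟧ * z) x z

  F₂-formula-scaled : ∀ n → F₂-formula n w x z * P ≡ G n w x z * P - G (n ∸ 1) (w + z) x z
  F₂-formula-scaled n =
    trans (distrib (G n w x z) (g // P) P) (cong (λ t → G n w x z * P - t) (//-*-cancel g P≢0))
    where
    g : ℚ
    g = G (n ∸ 1) (w + z) x z
    distrib : ∀ a c p → (a - c) * p ≡ a * p - c * p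
    distrib = solve-∀ ℚ-ring

  Ff₂-sum-scaled : ∀ f m →
    (∀ {j} → suc j ≤ m → Ff (2 ℕ.+ f) 2 (3 ℕ.+ j) w x z ≡ F₂-formula (3 ℕ.+ j) w x z) →
    sumTo m (λ i → (T m i * Ff (2 ℕ.+ f) 2 (2 ℕ.+ i) w x z) // D m) * (D m * P) ≡ A m * P - S m
  Ff₂-sum-scaled f m IH = begin
    sumTo m (λ i → (T m i * Ff (2 ℕ.+ f) 2 (2 ℕ.+ i) w x z) // D m) * (D m * P)
      ≡⟨ sumTo-*-distribʳ m _ (D m * P) ⟩
    sumTo m (λ i → (T m i * Ff (2 ℕ.+ f) 2 (2 ℕ.+ i) w x z) // D m * (D m * P))
      ≡⟨ sumTo-cong m term ⟩
    sumTo m (λ i → G (2 ℕ.+ i) w x z * T m i * P - G (suc i) (w + z) x z * T m i)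
      ≡⟨ sumTo-*-minus m (λ i → G (2 ℕ.+ i) w x z * T m i) P (λ i → G (suc i) (w + z) x z * T m i) ⟩
    A m * P - S m ∎
    where
    open ≡-Reasoning
    distribute : ∀ t u p v → t * (u * p - v) ≡ u * t * p - v * t
    distribute = solve-∀ ℚ-ring

    term : ∀ {i} → 1 ≤ i → i ≤ m →
      (T m i * Ff (2 ℕ.+ f) 2 (2 ℕ.+ i) w x z) // D m * (D m * P)
      ≡ G (2 ℕ.+ i) w x z * T m i * P - G (suc i) (w + z) x z * T m i
    term {i@(suc j)} _ i≤m = begin
      (T m i * Ff (2 ℕ.+ f) 2 (3 ℕ.+ j) w x z) // D m * (D m * P)  ≡⟨ //-*-cancelˡ _ P (D≢0 m) ⟩
      T m i * Ff (2 ℕ.+ f) 2 (3 ℕ.+ j) w x z * P                  ≡⟨ cong (λ F → T m i * F * P) (IH i≤m) ⟩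
      T m i * F₂-formula (3 ℕ.+ j) w x z * P                      ≡⟨ *-assoc (T m i) (F₂-formula (3 ℕ.+ j) w x z) P ⟩
      T m i * (F₂-formula (3 ℕ.+ j) w x z * P)                    ≡⟨ cong (T m i *_) (F₂-formula-scaled (3 ℕ.+ j)) ⟩
      T m i * (G (3 ℕ.+ j) w x z * P - G (2 ℕ.+ j) (w + z) x z)   ≡⟨ distribute (T m i) (G (3 ℕ.+ j) w x z) P (G (2 ℕ.+ j) (w + z) x z) ⟩
      G (3 ℕ.+ j) w x z * T m i * P - G (2 ℕ.+ j) (w + z) x z * T m i ∎

  Ff₂-last-term-scaled : ∀ m →
    ((w + ⟦ 1 ⟧ * z) * G 1 (w + x) x z * G (2 ℕ.+ m) (w + ⟦ 1 ⟧ * z) x z) // (w * D m) * (D m * P)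
    ≡ (w + z) * G 1 (w + x) x z * G (2 ℕ.+ m) (w + z) x z * (w + x)
  Ff₂-last-term-scaled m = begin
    X // (w * D m) * (D m * P)                ≡⟨ cong (X // (w * D m) *_) (x∙yz≈yx∙z (D m) w (w + x)) ⟩
    X // (w * D m) * ((w * D m) * (w + x))    ≡⟨ //-*-cancelˡ X (w + x) (*-≢0 w≢0 (D≢0 m)) ⟩
    X * (w + x)                               ≡⟨ cong (λ v → v * G 1 (w + x) x z * G (2 ℕ.+ m) v x z * (w + x)) w+1z≡w+z ⟩
    (w + z) * G 1 (w + x) x z * G (2 ℕ.+ m) (w + z) x z * (w + x) ∎
    where
    open ≡-Reasoning
    X : ℚ
    X = (w + ⟦ 1 ⟧ * z) * G 1 (w + x) x z * G (2 ℕ.+ m) (w + ⟦ 1 ⟧ * z) x z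

  Ff₂-step : ∀ f m →
    (∀ {j} → suc j ≤ m → Ff (2 ℕ.+ f) 2 (3 ℕ.+ j) w x z ≡ F₂-formula (3 ℕ.+ j) w x z) →
    Ff (3 ℕ.+ f) 2 (3 ℕ.+ m) w x z ≡ F₂-formula (3 ℕ.+ m) w x z
  Ff₂-step f m IH = *-cancelʳ-≢0 (D m * P) (*-≢0 (D≢0 m) P≢0) (begin
    (Σ + (0ℚ + X // (w * D m))) * (D m * P)          ≡⟨ *-distribʳ-+ (D m * P) Σ (0ℚ + X // (w * D m)) ⟩
    Σ * (D m * P) + (0ℚ + X // (w * D m)) * (D m * P)
      ≡⟨ cong₂ _+_ (Ff₂-sum-scaled f m IH)
                   (trans (cong (_* (D m * P)) (+-identityˡ (X // (w * D m)))) (Ff₂-last-term-scaled m)) ⟩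
    A m * P - S m + (w + z) * G 1 (w + x) x z * g * (w + x)
      ≡⟨ F₂-key-identity w (w + x) (w + z) (D m) ((w + z) + ⟦ suc m ⟧ * x) (G (3 ℕ.+ m) w x z) g
           (G (suc m) (w + ⟦ 2 ⟧ * z) x z) (A m) (S m)
           (G 1 w x z) (G 1 (w + x) x z) (G 1 (w + z) x z) (G 2 w x z)
           (D-split m) (G₁-inverse w≢0) (G₁-inverse w+x≢0) G₂-recurrence
           (Gₙ-recurrence m) (Gₙ₋₁-recurrence m) ⟩
    (G (3 ℕ.+ m) w x z * P - g) * D m                 ≡⟨ cong (_* D m) (sym (F₂-formula-scaled (3 ℕ.+ m))) ⟩
    F₂-formula (3 ℕ.+ m) w x z * P * D m              ≡⟨ sym (x∙yz≈xz∙y (F₂-formula (3 ℕ.+ m) w x z) (D m) P) ⟩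
    F₂-formula (3 ℕ.+ m) w x z * (D m * P)            ∎)
    where
    open ≡-Reasoning
    g Σ X : ℚ
    g = G (2 ℕ.+ m) (w + z) x z
    Σ = sumTo m (λ i → (T m i * Ff (2 ℕ.+ f) 2 (2 ℕ.+ i) w x z) // D m)
    X = (w + ⟦ 1 ⟧ * z) * G 1 (w + x) x z * G (2 ℕ.+ m) (w + ⟦ 1 ⟧ * z) x z

  Ff₂≡F₂-formula : ∀ f m → 3 ℕ.+ m ≤ f → Ff f 2 (3 ℕ.+ m) w x z ≡ F₂-formula (3 ℕ.+ m) w x z
  Ff₂≡F₂-formula (suc (suc (suc f))) m (s≤s (s≤s (s≤s m≤f))) =
    Ff₂-step f m (λ j<m → Ff₂≡F₂-formula (suc (suc f)) _ (s≤s (s≤s (ℕ.≤-trans j<m m≤f))))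

theorem2p1 : (n : ℕ) → 3 ≤ n → (w x z : ℚ) →
    ((a b : ℕ) → w + ⟦ a ⟧ * x + ⟦ b ⟧ * z ≢ 0ℚ) →
    F 2 n w x z ≡ G n w x z - G (n ∸ 1) (w + z) x z // (w * (w + x))
theorem2p1 (suc (suc (suc m))) (s≤s (s≤s (s≤s _))) w x z w+ax+bz≢0 =
  Ff₂≡F₂-formula w x z w+ax+bz≢0 (3 ℕ.+ m) m ℕ.≤-refl
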